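{- Let $[\![\cdot]\!]:\mathcal{P}_S\to\mathcal{P}_T$ be an encoding that is fully abstract with respect to $\mathcal{R}_S\subseteq\mathcal{P}_S^2$ and $\mathcal{R}_T\subseteq\mathcal{P}_T^2$, and let $\mathcal{R}\subseteq(\mathcal{P}_S\uplus\mathcal{P}_T)^2$ be transitive with $(S,[\![S]\!])\in\mathcal{R}$ and $([\![S]\!],S)\in\mathcal{R}$ for all $S\in\mathcal{P}_S$. Then $\mathcal{R}_S=\mathcal{R}|_{\mathcal{P}_S}$ if and only if for all $S_1,S_2\in\mathcal{P}_S$: $([\![S_1]\!],[\![S_2]\!])\in\mathcal{R}_T$ iff $([\![S_1]\!],[\![S_2]\!])\in\mathcal{R}$.
   Context: Fully abstract w.r.t. $\mathcal{R}_S,\mathcal{R}_T$: for all $S_1,S_2\in\mathcal{P}_S$, $(S_1,S_2)\in\mathcal{R}_S$ iff $([\![S_1]\!],[\![S_2]\!])\in\mathcal{R}_T$. $\mathcal{R}|_{B'}=\{(x,y)\mid x,y\in B',(x,y)\in\mathcal{R}\}$. -}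

module Defs where

open import Level using (Level; _⊔_)
open import Data.Sum using (_⊎_; inj₁; inj₂)
open import Data.Product using (_×_)
open import Relation.Binary.Core using (Rel)

_⟺_ : ∀ {a b} → Set a → Set b → Set (a ⊔ b)
A ⟺ B = (A → B) × (B → A)

FullyAbstract : ∀ {s t ℓs ℓt} {PS : Set s} {PT : Set t} →
  (PS → PT) → Rel PS ℓs → Rel PT ℓt → Set (s ⊔ ℓs ⊔ ℓt)
FullyAbstract {PS = PS} enc RS RT =
  ∀ (S₁ S₂ : PS) → RS S₁ S₂ ⟺ RT (enc S₁) (enc S₂)

restrictS : ∀ {s t ℓ} {PS : Set s} {PT : Set t} → Rel (PS ⊎ PT) ℓ → Rel PS ℓ
restrictS R x y = R (inj₁ x) (inj₁ y)

-- Transitivity through the round trips S → ⟦S⟧ → S makes R relate two source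
-- terms exactly when it relates their encodings, and full abstraction makes
-- R_S relate them exactly when R_T relates their encodings.  The two sides
-- of the theorem therefore compare pointwise equivalent relations.
module Submission where

open import Defs
open import Level using (Level)
open import Function using (_∘_)
open import Data.Sum using (_⊎_; inj₁; inj₂)
open import Data.Product using (_,_; proj₁; proj₂)
open import Relation.Binary.Core using (Rel)
open import Relation.Binary.Definitions using (Transitive)

private
  variable
    a : Level
    A B C D : Set a

⟺-sym : A ⟺ B → B ⟺ A
⟺-sym (f , g) = g , f

⟺-trans : A ⟺ B → B ⟺ C → A ⟺ C
⟺-trans (f , g) (h , k) = h ∘ f , g ∘ k

⟺-cong : A ⟺ C → B ⟺ D → (A ⟺ B) ⟺ (C ⟺ D)
⟺-cong A⟺C B⟺D =
    (λ A⟺B → ⟺-trans (⟺-sym A⟺C) (⟺-trans A⟺B B⟺D))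
  , (λ C⟺D → ⟺-trans A⟺C (⟺-trans C⟺D (⟺-sym B⟺D)))

⟺-cong-∀ : ∀ {ι p q p′ q′} {I : Set ι}
           {P : I → I → Set p} {Q : I → I → Set q}
           {P′ : I → I → Set p′} {Q′ : I → I → Set q′} →
           (∀ i j → P i j ⟺ P′ i j) → (∀ i j → Q i j ⟺ Q′ i j) →
           (∀ i j → P i j ⟺ Q i j) ⟺ (∀ i j → P′ i j ⟺ Q′ i j)
⟺-cong-∀ P⟺P′ Q⟺Q′ =
    (λ h i j → proj₁ (⟺-cong (P⟺P′ i j) (Q⟺Q′ i j)) (h i j))
  , (λ h i j → proj₂ (⟺-cong (P⟺P′ i j) (Q⟺Q′ i j)) (h i j))

module _ {ℓ} {R : Rel A ℓ} (trans : Transitive R) where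

  trans-⟺ : ∀ {x x′ y y′} → R x x′ → R x′ x → R y y′ → R y′ y →
            R x y ⟺ R x′ y′
  trans-⟺ xx′ x′x yy′ y′y =
      (λ xy → trans x′x (trans xy yy′))
    , (λ x′y′ → trans xx′ (trans x′y′ y′y))

lemma14 : ∀ {s t ℓs ℓt ℓ} {PS : Set s} {PT : Set t}
    (enc : PS → PT) (RS : Rel PS ℓs) (RT : Rel PT ℓt)
    (R : Rel (PS ⊎ PT) ℓ) →
    FullyAbstract enc RS RT →
    Transitive R →
    (∀ (S : PS) → R (inj₁ S) (inj₂ (enc S))) →
    (∀ (S : PS) → R (inj₂ (enc S)) (inj₁ S)) →
    ((∀ (S₁ S₂ : PS) → RS S₁ S₂ ⟺ restrictS R S₁ S₂)
    ⟺
    (∀ (S₁ S₂ : PS) → RT (enc S₁) (enc S₂) ⟺ R (inj₂ (enc S₁)) (inj₂ (enc S₂))))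
lemma14 enc RS RT R fullyAbstract trans S→⟦S⟧ ⟦S⟧→S =
  ⟺-cong-∀ fullyAbstract restrict⟺encoded
  where
  restrict⟺encoded : ∀ S₁ S₂ →
    restrictS R S₁ S₂ ⟺ R (inj₂ (enc S₁)) (inj₂ (enc S₂))
  restrict⟺encoded S₁ S₂ =
    trans-⟺ {R = R} trans (S→⟦S⟧ S₁) (⟦S⟧→S S₁) (S→⟦S⟧ S₂) (⟦S⟧→S S₂)
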